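{- Let $F$ be a $3$-CNF and let $(l_1 \vee l_2) \in \mathcal{B}(F)$. If there exists $C \in \mathcal{TB}(F, l_1 = 1)$ such that $l_2 \in C$, then $F$ is satisfiable if and only if $(F \setminus \{C^F\}) \cup \{C\}$ is satisfiable.
   Context: A $3$-CNF is viewed as a set of clauses, each with at most $3$ literals. For a CNF $G$, $\mathcal{T}(G)$ and $\mathcal{B}(G)$ denote the sets of clauses of $G$ with exactly $3$ and exactly $2$ literals respectively. For a partial assignment $\alpha$, $F|\alpha$ is obtained by removing every clause satisfied by $\alpha$ and deleting from the remaining clauses the literals set to $0$ by $\alpha$ (an emptied clause becomes $\bot$). $\textsf{UP}(G)$ is the formula obtained from $G$ by repeatedly applying unit propagation until no $1$-literal clause remains. For a clause $C$ of a formula derived from $F$ by assigning variables, $C^F$ denotes the clause of $F$ from which $C$ was derived. Define $\mathcal{TB}(F,\alpha) = \{C : C \in \mathcal{B}(\textsf{UP}(F|\alpha)),\ C^F \in \mathcal{T}(F)\}$, i.e., the $2$-literal clauses of $\textsf{UP}(F|\alpha)$ that originate from $3$-literal clauses of $F$. $\mathcal{TB}(F, l_1=1)$ means $\mathcal{TB}(F,\alpha)$ for the partial assignment $\alpha$ setting literal $l_1$ to $1$. -}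

module Defs where

open import Data.Nat using (ℕ; zero; suc; _≤_; _≡ᵇ_)
open import Data.Bool using (Bool; true; false; not; _∧_; if_then_else_)
open import Data.Maybe using (Maybe; just; nothing)
open import Data.List using (List; []; _∷_; length; filterᵇ)
open import Data.Bool.ListAction using (any; all)
open import Data.List.Relation.Unary.All using (All)
open import Data.List.Relation.Unary.Any using (Any)
open import Data.List.Relation.Unary.Unique.Propositional using (Unique)
open import Data.List.Membership.Propositional using (_∈_)
open import Data.Product using (_×_; _,_; ∃-syntax)
open import Relation.Binary.PropositionalEquality using (_≡_)

data Lit : Set where
  pos : ℕ → Lit
  neg : ℕ → Lit

var : Lit → ℕ
var (pos x) = x
var (neg x) = x

_==L_ : Lit → Lit → Bool
pos x ==L pos y = x ≡ᵇ y
neg x ==L neg y = x ≡ᵇ y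
_ ==L _ = false

-- A clause is a (duplicate-free, see Is3CNF) list of literals, read as a set.
Clause : Set
Clause = List Lit

-- A CNF is a list of clauses, read as a set of clauses.
CNF : Set
CNF = List Clause

Assignment : Set
Assignment = ℕ → Bool

evalLit : Assignment → Lit → Bool
evalLit σ (pos x) = σ x
evalLit σ (neg x) = not (σ x)

SatClause : Assignment → Clause → Set
SatClause σ D = Any (λ l → evalLit σ l ≡ true) D

Satisfiable : CNF → Set
Satisfiable F = ∃[ σ ] All (SatClause σ) F

-- 3-CNF: every clause is a set (no repeated literal) of at most 3 literals.
-- Hence the number of literals of a clause is its length.
Is3CNF : CNF → Set
Is3CNF F = All (λ D → Unique D × length D ≤ 3) F

PAssign : Set
PAssign = ℕ → Maybe Bool

empty : PAssign
empty _ = nothing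

negB : Maybe Bool → Maybe Bool
negB (just b) = just (not b)
negB nothing = nothing

litVal : PAssign → Lit → Maybe Bool
litVal α (pos x) = α x
litVal α (neg x) = negB (α x)

setLit : PAssign → Lit → PAssign
setLit α l y = if var l ≡ᵇ y then just (isPos l) else α y
  where
  isPos : Lit → Bool
  isPos (pos _) = true
  isPos (neg _) = false

isTrue : Maybe Bool → Bool
isTrue (just true) = true
isTrue _ = false

isUnset : Maybe Bool → Bool
isUnset nothing = true
isUnset (just _) = false

clauseSatB : PAssign → Clause → Bool
clauseSatB α D = any (λ l → isTrue (litVal α l)) D

-- D|α for a clause not satisfied by α: delete the literals set to 0
restrictClause : PAssign → Clause → Clause
restrictClause α D = filterᵇ (λ l → isUnset (litVal α l)) D

-- F|α, each remaining clause paired with its origin C^F in F: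
-- entries are (C^F , C).
restrict : PAssign → CNF → List (Clause × Clause)
restrict α [] = []
restrict α (D ∷ F) =
  if clauseSatB α D then restrict α F else (D , restrictClause α D) ∷ restrict α F

findUnit : PAssign → CNF → Maybe Lit
findUnit α [] = nothing
findUnit α (D ∷ F) with clauseSatB α D | restrictClause α D
... | false | l ∷ [] = just l
... | _ | _ = findUnit α F

-- repeatedly set a unit literal to 1; each step satisfies one more clause
-- of F, so  length F  steps always reach a fixpoint (no 1-literal clause).
propagate : ℕ → CNF → PAssign → PAssign
propagate zero F α = α
propagate (suc n) F α with findUnit α F
... | just l = propagate n F (setLit α l)
... | nothing = α

upAssign : CNF → PAssign → PAssign
upAssign F α = propagate (length F) F α

UP : CNF → PAssign → List (Clause × Clause)
UP F α = restrict (upAssign F α) F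

assign1 : Lit → PAssign
assign1 l = setLit empty l

InTB : CNF → PAssign → Clause → Clause → Set
InTB F α CF C = ((CF , C) ∈ UP F α) × length CF ≡ 3 × length C ≡ 2

InB2 : CNF → Lit → Lit → Set
InB2 F l1 l2 = ∃[ B ] (B ∈ F × length B ≡ 2 × l1 ∈ B × l2 ∈ B)

subsetB : Clause → Clause → Bool
subsetB D E = all (λ l → any (λ m → l ==L m) E) D

sameClauseB : Clause → Clause → Bool
sameClauseB D E = subsetB D E ∧ subsetB E D

removeClause : Clause → CNF → CNF
removeClause D F = filterᵇ (λ E → not (sameClauseB D E)) F

-- Replacing C^F by its subclause C can only make F harder to satisfy, so one direction is
-- immediate. Conversely let σ satisfy F. If σ makes l₁ true, σ is consistent with every step of
-- unit propagation from l₁ = 1, hence satisfies every clause of UP(F|l₁=1), C among them. If σ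
-- makes l₁ false, the binary clause l₁ ∨ l₂ forces l₂, which lies in C. (l₁ ≠ l₂, since l₁ is
-- assigned by the propagation while l₂ survives in C.)
module Submission where

open import Defs
open import Data.List using (_∷_)
open import Data.List.Membership.Propositional using (_∈_)
open import Function.Bundles using (_⇔_)

open import Data.Bool using (true; false; not; T; T?)
open import Data.Bool.Properties using (T-≡; T-∧)
open import Data.Empty using (⊥-elim)
open import Data.List using (List; []; length)
open import Data.List.Membership.Propositional using (find; lose)
open import Data.List.Membership.Propositional.Properties using (∈-filter⁻; ∈-filter⁺)
open import Data.List.Relation.Binary.Subset.Propositional using (_⊆_)
open import Data.List.Relation.Binary.Subset.Propositional.Properties
  using (⊆-trans; Any-resp-⊆; All-resp-⊇; filter-⊆)
open import Data.List.Relation.Unary.All as All using (All; _∷_)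
open import Data.List.Relation.Unary.All.Properties using (all⁺)
open import Data.List.Relation.Unary.Any using (here; there)
open import Data.List.Relation.Unary.Any.Properties using (any⁺; any⁻)
open import Data.Maybe using (just; nothing)
open import Data.Nat using (zero; suc; _≡ᵇ_)
open import Data.Nat.Properties using (≡ᵇ⇒≡; ≡⇒≡ᵇ)
open import Data.Product using (_×_; _,_; ∃-syntax; proj₁; proj₂)
import Data.Product as Product
open import Data.Sum using (_⊎_; inj₁; inj₂)
open import Function using (_∘_; id; Equivalence; mk⇔)
open import Relation.Binary.PropositionalEquality using (_≡_; _≢_; refl; sym; trans; cong; subst)

≡ᵇ-refl : ∀ n → (n ≡ᵇ n) ≡ true
≡ᵇ-refl n = Equivalence.to T-≡ (≡⇒≡ᵇ n n refl)

≡ᵇ-true⇒≡ : ∀ m n → (m ≡ᵇ n) ≡ true → m ≡ n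
≡ᵇ-true⇒≡ m n = ≡ᵇ⇒≡ m n ∘ Equivalence.from T-≡

==L⇒≡ : ∀ l m → T (l ==L m) → l ≡ m
==L⇒≡ (pos x) (pos y) p = cong pos (≡ᵇ⇒≡ x y p)
==L⇒≡ (neg x) (neg y) p = cong neg (≡ᵇ⇒≡ x y p)

subsetB⇒⊆ : ∀ D E → T (subsetB D E) → D ⊆ E
subsetB⇒⊆ D E D⊆ᵇE {l} l∈D with find (any⁻ _ E (All.lookup (all⁺ _ D D⊆ᵇE) l∈D))
... | m , m∈E , l==m = subst (_∈ E) (sym (==L⇒≡ l m l==m)) m∈E

Agree : Assignment → PAssign → Set
Agree σ β = ∀ x {b} → β x ≡ just b → σ x ≡ b

_⊑_ : PAssign → PAssign → Set
α ⊑ β = ∀ x {b} → α x ≡ just b → β x ≡ just b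

⊑-refl : ∀ {α} → α ⊑ α
⊑-refl _ = id

⊑-trans : ∀ {α β γ} → α ⊑ β → β ⊑ γ → α ⊑ γ
⊑-trans α⊑β β⊑γ x = β⊑γ x ∘ α⊑β x

Unset : PAssign → Lit → Set
Unset β l = T (isUnset (litVal β l))

evalLit-agree : ∀ {σ β} l {b} → Agree σ β → litVal β l ≡ just b → evalLit σ l ≡ b
evalLit-agree (pos x) σ⊨β βl = σ⊨β x βl
evalLit-agree {β = β} (neg x) σ⊨β βl with β x in βx
evalLit-agree (neg x) σ⊨β refl | just c = cong not (σ⊨β x βx)

litVal-mono : ∀ {α β} l {b} → α ⊑ β → litVal α l ≡ just b → litVal β l ≡ just b
litVal-mono (pos x) α⊑β αl = α⊑β x αl
litVal-mono {α} (neg x) α⊑β αl with α x in αx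
litVal-mono (neg x) α⊑β refl | just c = cong negB (α⊑β x αx)

litVal-setLit : ∀ α l → litVal (setLit α l) l ≡ just true
litVal-setLit α (pos x) rewrite ≡ᵇ-refl x = refl
litVal-setLit α (neg x) rewrite ≡ᵇ-refl x = refl

setLit-agree : ∀ {σ β} l → Agree σ β → evalLit σ l ≡ true → Agree σ (setLit β l)
setLit-agree l σ⊨β σl y eq with var l ≡ᵇ y in e
setLit-agree l σ⊨β σl y eq | false = σ⊨β y eq
setLit-agree (pos x) σ⊨β σl y refl | true rewrite ≡ᵇ-true⇒≡ x y e = σl
setLit-agree {σ} (neg x) σ⊨β σl y refl | true rewrite ≡ᵇ-true⇒≡ x y e with σ y
... | false = refl
setLit-agree (neg x) σ⊨β () y refl | true | true

Unset⇒var-unassigned : ∀ α l → Unset α l → α (var l) ≡ nothing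
Unset⇒var-unassigned α (pos x) u with α x
... | nothing = refl
Unset⇒var-unassigned α (neg x) u with α x
... | nothing = refl

setLit-extends : ∀ {α} l → Unset α l → α ⊑ setLit α l
setLit-extends {α} l u y αy with var l ≡ᵇ y in e
... | false = αy
... | true with trans (sym αy) (subst (λ z → α z ≡ nothing) (≡ᵇ-true⇒≡ (var l) y e)
                                          (Unset⇒var-unassigned α l u))
...   | ()

∈-restrictClause⁻ : ∀ {β D l} → l ∈ restrictClause β D → l ∈ D × Unset β l
∈-restrictClause⁻ {β} = ∈-filter⁻ (T? ∘ λ l → isUnset (litVal β l))

∈-restrictClause⁺ : ∀ {β D l} → l ∈ D → Unset β l → l ∈ restrictClause β D
∈-restrictClause⁺ {β} = ∈-filter⁺ (T? ∘ λ l → isUnset (litVal β l))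

restrictClause-sat : ∀ {σ β D} → Agree σ β → clauseSatB β D ≡ false →
  SatClause σ D → SatClause σ (restrictClause β D)
restrictClause-sat {σ} {β} {D} σ⊨β unsat σ⊨D with find σ⊨D
... | l , l∈D , σl with litVal β l in βl
...   | nothing = lose (∈-restrictClause⁺ l∈D (subst (T ∘ isUnset) (sym βl) _)) σl
...   | just b = ⊥-elim (subst T unsat (any⁺ _ (lose l∈D β-sat-l)))
  where
  β-sat-l : T (isTrue (litVal β l))
  β-sat-l rewrite βl | trans (sym (evalLit-agree l σ⊨β βl)) σl = _

findUnit-unit : ∀ β F {l} → findUnit β F ≡ just l →
  ∃[ D ] (D ∈ F × clauseSatB β D ≡ false × restrictClause β D ≡ l ∷ [])
findUnit-unit β (D ∷ F) eq with clauseSatB β D in sat | restrictClause β D in res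
findUnit-unit β (D ∷ F) refl | false | _ ∷ [] = D , here refl , sat , res
... | true | _ = Product.map₂ (Product.map₁ there) (findUnit-unit β F eq)
... | false | [] = Product.map₂ (Product.map₁ there) (findUnit-unit β F eq)
... | false | _ ∷ _ ∷ _ = Product.map₂ (Product.map₁ there) (findUnit-unit β F eq)

findUnit-unset : ∀ β F {l} → findUnit β F ≡ just l → Unset β l
findUnit-unset β F {l} eq with findUnit-unit β F eq
... | D , _ , _ , res = proj₂ (∈-restrictClause⁻ {D = D} (subst (l ∈_) (sym res) (here refl)))

findUnit-forced : ∀ {σ β F l} → All (SatClause σ) F → Agree σ β →
  findUnit β F ≡ just l → evalLit σ l ≡ true
findUnit-forced {σ} {β} {F} σ⊨F σ⊨β eq with findUnit-unit β F eq
... | D , D∈F , unsat , res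
  with subst (SatClause σ) res (restrictClause-sat σ⊨β unsat (All.lookup σ⊨F D∈F))
...   | here σl = σl

propagate-extends : ∀ n F β → β ⊑ propagate n F β
propagate-extends zero F β = ⊑-refl
propagate-extends (suc n) F β with findUnit β F in eq
... | nothing = ⊑-refl
... | just l =
  ⊑-trans (setLit-extends l (findUnit-unset β F eq)) (propagate-extends n F (setLit β l))

propagate-agree : ∀ n F {σ β} → All (SatClause σ) F → Agree σ β → Agree σ (propagate n F β)
propagate-agree zero F σ⊨F σ⊨β = σ⊨β
propagate-agree (suc n) F {β = β} σ⊨F σ⊨β with findUnit β F in eq
... | nothing = σ⊨β
... | just l = propagate-agree n F σ⊨F (setLit-agree l σ⊨β (findUnit-forced σ⊨F σ⊨β eq))

∈-restrict⁻ : ∀ α F {D E} → (D , E) ∈ restrict α F →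
  D ∈ F × clauseSatB α D ≡ false × E ≡ restrictClause α D
∈-restrict⁻ α (D ∷ F) DE∈ with clauseSatB α D in sat
... | true = Product.map₁ there (∈-restrict⁻ α F DE∈)
∈-restrict⁻ α (D ∷ F) (here refl) | false = here refl , sat , refl
∈-restrict⁻ α (D ∷ F) (there DE∈) | false = Product.map₁ there (∈-restrict⁻ α F DE∈)

UP-sound : ∀ {σ} F α {D E} → All (SatClause σ) F → Agree σ α → (D , E) ∈ UP F α → SatClause σ E
UP-sound F α σ⊨F σ⊨α DE∈ with ∈-restrict⁻ (upAssign F α) F DE∈
... | D∈F , unsat , refl =
  restrictClause-sat (propagate-agree (length F) F σ⊨F σ⊨α) unsat (All.lookup σ⊨F D∈F)

∈-UP-clause⁻ : ∀ F α {D E l} → (D , E) ∈ UP F α → l ∈ E → l ∈ D × Unset (upAssign F α) l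
∈-UP-clause⁻ F α DE∈ l∈E with ∈-restrict⁻ (upAssign F α) F DE∈
... | _ , _ , refl = ∈-restrictClause⁻ l∈E

length≡2-other : ∀ {A : Set} {xs : List A} {x y z} → length xs ≡ 2 → x ∈ xs → y ∈ xs → x ≢ y →
  z ∈ xs → z ≢ x → z ≡ y
length≡2-other {xs = _ ∷ _ ∷ []} _ (here refl) (here refl) x≢y _ _ = ⊥-elim (x≢y refl)
length≡2-other {xs = _ ∷ _ ∷ []} _ (there (here refl)) (there (here refl)) x≢y _ _ =
  ⊥-elim (x≢y refl)
length≡2-other {xs = _ ∷ _ ∷ []} _ (here refl) (there (here refl)) _ (here refl) z≢x =
  ⊥-elim (z≢x refl)
length≡2-other {xs = _ ∷ _ ∷ []} _ (here refl) (there (here refl)) _ (there (here refl)) _ = refl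
length≡2-other {xs = _ ∷ _ ∷ []} _ (there (here refl)) (here refl) _ (here refl) _ = refl
length≡2-other {xs = _ ∷ _ ∷ []} _ (there (here refl)) (here refl) _ (there (here refl)) z≢x =
  ⊥-elim (z≢x refl)

two-clause-forces : ∀ {σ B l₁ l₂} → length B ≡ 2 → l₁ ∈ B → l₂ ∈ B → l₁ ≢ l₂ →
  SatClause σ B → evalLit σ l₁ ≡ false → evalLit σ l₂ ≡ true
two-clause-forces {σ} {l₁ = l₁} ∣B∣≡2 l₁∈B l₂∈B l₁≢l₂ σ⊨B σl₁ with find σ⊨B
... | l , l∈B , σl =
  subst (λ m → evalLit σ m ≡ true) (length≡2-other ∣B∣≡2 l₁∈B l₂∈B l₁≢l₂ l∈B l≢l₁) σl
  where
  l≢l₁ : l ≢ l₁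
  l≢l₁ refl with trans (sym σl) σl₁
  ... | ()

∈-removeClause : ∀ {D F E} → E ∈ F → D ⊆ E ⊎ E ∈ removeClause D F
∈-removeClause {D} {F} {E} E∈F with sameClauseB D E in same
... | true = inj₁ (subsetB⇒⊆ D E (proj₁ (Equivalence.to T-∧ (subst T (sym same) _))))
... | false = inj₂ (∈-filter⁺ (T? ∘ (not ∘ sameClauseB D)) E∈F (subst (T ∘ not) (sym same) _))

removeClause-restore : ∀ {σ D F C} → C ⊆ D →
  All (SatClause σ) (C ∷ removeClause D F) → All (SatClause σ) F
removeClause-restore {σ} {D} {F} C⊆D (σ⊨C ∷ σ⊨F∖D) = All.tabulate restore
  where
  restore : ∀ {E} → E ∈ F → SatClause σ E
  restore E∈F with ∈-removeClause {D} E∈F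
  ... | inj₁ D⊆E = Any-resp-⊆ (⊆-trans C⊆D D⊆E) σ⊨C
  ... | inj₂ E∈F∖D = All.lookup σ⊨F∖D E∈F∖D

TB-clause-implied : ∀ {σ} F {l₁ l₂ CF C} → All (SatClause σ) F → InB2 F l₁ l₂ →
  (CF , C) ∈ UP F (assign1 l₁) → l₂ ∈ C → SatClause σ C
TB-clause-implied {σ} F {l₁} {l₂} {CF} σ⊨F (B , B∈F , ∣B∣≡2 , l₁∈B , l₂∈B) CF,C∈UP l₂∈C
  with evalLit σ l₁ in σl₁
... | true = UP-sound F (assign1 l₁) σ⊨F (setLit-agree l₁ (λ _ ()) σl₁) CF,C∈UP
... | false = lose l₂∈C (two-clause-forces ∣B∣≡2 l₁∈B l₂∈B l₁≢l₂ (All.lookup σ⊨F B∈F) σl₁)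
  where
  β = upAssign F (assign1 l₁)
  l₂-unset : Unset β l₂
  l₂-unset = proj₂ (∈-UP-clause⁻ F (assign1 l₁) CF,C∈UP l₂∈C)
  l₁-set : litVal β l₁ ≡ just true
  l₁-set = litVal-mono l₁ (propagate-extends (length F) F (assign1 l₁)) (litVal-setLit empty l₁)
  l₁≢l₂ : l₁ ≢ l₂
  l₁≢l₂ refl = subst (T ∘ isUnset) l₁-set l₂-unset

lemma6p2 : (F : CNF) (l₁ l₂ : Lit) → Is3CNF F → InB2 F l₁ l₂
    → (CF C : Clause) → InTB F (assign1 l₁) CF C → l₂ ∈ C
    → (Satisfiable F ⇔ Satisfiable (C ∷ removeClause CF F))
lemma6p2 F l₁ l₂ _ l₁∨l₂∈F CF C (CF,C∈UP , _ , _) l₂∈C = mk⇔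
  (λ (σ , σ⊨F) → σ , TB-clause-implied F σ⊨F l₁∨l₂∈F CF,C∈UP l₂∈C ∷ All-resp-⊇ (filter-⊆ _ F) σ⊨F)
  (Product.map₂ (removeClause-restore C⊆CF))
  where
  C⊆CF : C ⊆ CF
  C⊆CF = proj₁ ∘ ∈-UP-clause⁻ F (assign1 l₁) CF,C∈UP
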